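{- (1) There is no infinite squarefree word $\mathbf{x}$ such that $\operatorname{nsc}_{\mathbf{x}}(n)<2n$ for all $n\ge1$. (2) There is no infinite cubefree word $\mathbf{x}$ such that $\operatorname{nsc}_{\mathbf{x}}(n)<\frac32 n$ for all $n\ge1$.
   Context: A word is squarefree (resp. cubefree) if it has no nonempty factor of the form $uu$ (resp. $uuu$). For an infinite word $\mathbf{x}=x_0x_1x_2\cdots$ (indexed from $0$) and $n\ge1$, $\operatorname{nsc}_{\mathbf{x}}(n)=\max\{m\in\mathbb{N}: x_i\cdots x_{i+n-1}\neq x_j\cdots x_{j+n-1}\text{ for all } 0\le i<j\le m-1\}$. -}

module Defs where

open import Data.Nat using (ℕ; _+_; _<_; _≤_)
open import Data.Product using (_×_)
open import Relation.Nullary using (¬_)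
open import Relation.Binary.PropositionalEquality using (_≡_; _≢_)

Word : Set → Set
Word A = ℕ → A

SameFactor : {A : Set} → Word A → ℕ → ℕ → ℕ → Set
SameFactor x n i j = ∀ k → k < n → x (i + k) ≡ x (j + k)

Squarefree : {A : Set} → Word A → Set
Squarefree x = ∀ i ℓ → 1 ≤ ℓ → ¬ (SameFactor x ℓ i (i + ℓ))

Cubefree : {A : Set} → Word A → Set
Cubefree x = ∀ i ℓ → 1 ≤ ℓ →
  ¬ (SameFactor x ℓ i (i + ℓ) × SameFactor x ℓ i (i + ℓ + ℓ))

DistinctFactors : {A : Set} → Word A → ℕ → ℕ → Set
DistinctFactors x n m = ∀ i j → i < j → j < m → ¬ (SameFactor x n i j)

-- nsc_x(n) = m : m is the maximum of {m ∈ ℕ : DistinctFactors x n m}.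
-- (If this set is unbounded, nsc_x(n) is undefined and no m satisfies this.)
IsNsc : {A : Set} → Word A → ℕ → ℕ → Set
IsNsc x n m = DistinctFactors x n m × (∀ m′ → DistinctFactors x n m′ → m′ ≤ m)

module Submission where

-- Both bounds already fail at the smallest lengths.
--
-- (1) A squarefree word has x₀ ≠ x₁ (otherwise x₀x₁ is a square), so the
--     length-1 factors at positions 0 and 1 differ and nsc(1) ≥ 2 = 2·1.
-- (2) For a cubefree word, either x₀ ≠ x₁, and then nsc(1) ≥ 2, i.e.
--     2·nsc(1) ≥ 4 > 3·1; or x₀ = x₁, and then the length-2 factors at
--     positions 0, 1, 2 are pairwise distinct (any coincidence forces
--     x₁ = x₂, making x₀x₁x₂ a cube), so nsc(2) ≥ 3, i.e. 2·nsc(2) ≥ 6 = 3·2.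

open import Defs
open import Data.Nat using (ℕ; _*_; _<_; _≤_; zero; suc; s≤s; z≤n)
open import Data.Nat.Properties using (<⇒≱; *-monoʳ-≤; +-identityʳ; ≤-trans)
open import Data.Product using (Σ; _×_; ∃; _,_)
open import Relation.Nullary using (¬_)
open import Relation.Binary.PropositionalEquality using (_≡_; sym; trans; subst₂)

pairs-below-2 : (P : ℕ → ℕ → Set) → P 0 1 → ∀ i j → i < j → j < 2 → P i j
pairs-below-2 P p01 zero (suc zero) _ _ = p01
pairs-below-2 P p01 _ (suc (suc _)) _ (s≤s (s≤s ()))
pairs-below-2 P p01 (suc _) (suc zero) (s≤s ()) _

pairs-below-3 : (P : ℕ → ℕ → Set) → P 0 1 → P 0 2 → P 1 2 →
                ∀ i j → i < j → j < 3 → P i j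
pairs-below-3 P p01 p02 p12 zero (suc zero) _ _ = p01
pairs-below-3 P p01 p02 p12 zero (suc (suc zero)) _ _ = p02
pairs-below-3 P p01 p02 p12 (suc zero) (suc (suc zero)) _ _ = p12
pairs-below-3 P p01 p02 p12 _ (suc (suc (suc _))) _ (s≤s (s≤s (s≤s ())))
pairs-below-3 P p01 p02 p12 (suc zero) (suc zero) (s≤s ()) _
pairs-below-3 P p01 p02 p12 (suc (suc _)) (suc zero) (s≤s ()) _
pairs-below-3 P p01 p02 p12 (suc (suc _)) (suc (suc zero)) (s≤s (s≤s ())) _

module _ {A : Set} (x : Word A) where

  letter⇒same-factor : ∀ {i j} → x i ≡ x j → SameFactor x 1 i j
  letter⇒same-factor {i} {j} e zero _ =
    subst₂ (λ a b → x a ≡ x b) (sym (+-identityʳ i)) (sym (+-identityʳ j)) e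
  letter⇒same-factor e (suc _) (s≤s ())

  nsc-lower-bound : ∀ {n m m′} → IsNsc x n m → DistinctFactors x n m′ → m′ ≤ m
  nsc-lower-bound (_ , maximal) distinct = maximal _ distinct

  distinct-first-two : ∀ {n} → ¬ SameFactor x n 0 1 → DistinctFactors x n 2
  distinct-first-two {n} h = pairs-below-2 (λ i j → ¬ SameFactor x n i j) h

  squarefree-first-letters : Squarefree x → ¬ SameFactor x 1 0 1
  squarefree-first-letters sq = sq 0 1 (s≤s z≤n)

  cubefree-no-triple : Cubefree x → x 0 ≡ x 1 → ¬ x 1 ≡ x 2
  cubefree-no-triple cf e01 e12 =
    cf 0 1 (s≤s z≤n) (letter⇒same-factor e01 , letter⇒same-factor (trans e01 e12))

  -- If x₀ = x₁ ≠ x₂, the length-2 factors at positions 0, 1, 2 are pairwise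
  -- distinct: each possible coincidence would force x₁ = x₂.
  distinct-first-three-pairs : x 0 ≡ x 1 → ¬ x 1 ≡ x 2 → DistinctFactors x 2 3
  distinct-first-three-pairs e01 n12 =
    pairs-below-3 (λ i j → ¬ SameFactor x 2 i j)
      (λ s → n12 (s 1 (s≤s (s≤s z≤n))))          -- x₀x₁ = x₁x₂ gives x₁ = x₂
      (λ s → n12 (trans (sym e01) (s 0 (s≤s z≤n)))) -- x₀x₁ = x₂x₃ gives x₀ = x₂
      (λ s → n12 (s 0 (s≤s z≤n)))                 -- x₁x₂ = x₂x₃ gives x₁ = x₂

mainTheorem13 :
    (¬ Σ Set λ A → Σ (Word A) λ x → Squarefree x ×
        (∀ n → 1 ≤ n → ∃ λ m → IsNsc x n m × m < 2 * n))
    ×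
    (¬ Σ Set λ A → Σ (Word A) λ x → Cubefree x ×
        (∀ n → 1 ≤ n → ∃ λ m → IsNsc x n m × 2 * m < 3 * n))
mainTheorem13 = squarefree-case , cubefree-case
  where
  squarefree-case : ¬ Σ Set λ A → Σ (Word A) λ x → Squarefree x ×
                      (∀ n → 1 ≤ n → ∃ λ m → IsNsc x n m × m < 2 * n)
  squarefree-case (_ , x , sq , bound) with bound 1 (s≤s z≤n)
  ... | _ , nsc₁ , small =
    <⇒≱ small (nsc-lower-bound x nsc₁
                 (distinct-first-two x (squarefree-first-letters x sq)))

  -- Either nsc(1) ≥ 2, giving 2·nsc(1) ≥ 4 > 3, or x₀ = x₁ and
  -- nsc(2) ≥ 3, giving 2·nsc(2) ≥ 6.
  cubefree-case : ¬ Σ Set λ A → Σ (Word A) λ x → Cubefree x ×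
                    (∀ n → 1 ≤ n → ∃ λ m → IsNsc x n m × 2 * m < 3 * n)
  cubefree-case (_ , x , cf , bound) with bound 1 (s≤s z≤n) | bound 2 (s≤s z≤n)
  ... | _ , nsc₁ , small₁ | _ , nsc₂ , small₂ =
    <⇒≱ small₁ (≤-trans (s≤s (s≤s (s≤s z≤n)))
                  (*-monoʳ-≤ 2 (nsc-lower-bound x nsc₁
                    (distinct-first-two x first-letters-differ))))
    where
    first-letters-differ : ¬ SameFactor x 1 0 1
    first-letters-differ s = <⇒≱ small₂ (*-monoʳ-≤ 2 (nsc-lower-bound x nsc₂
      (distinct-first-three-pairs x e01 (cubefree-no-triple x cf e01))))
      where
      e01 : x 0 ≡ x 1
      e01 = s 0 (s≤s z≤n)
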